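{- Let $\alpha>2$ be a real number that is not an integer. Consider a Nash equilibrium of the network creation game with parameter $\alpha$, and let $G$ be the resulting network. Fix any vertex $v$, and form the distance partition $N_1,N_2,\ldots$ of $V(G)\setminus\{v\}$ from $v$. Then every vertex of $N_2$ has at most $\lfloor\alpha-1\rfloor$ children.
   Context: The network creation game. There are $n$ agents (vertices) and a parameter $\alpha$. Each agent $v$ chooses a set $S_v$ of other vertices to which it buys edges. The network $G$ is the undirected graph with edges $\{v,w\}$ for $w\in S_v$; we say $v$ pays for these edges. Agent $v$'s cost is $\alpha|S_v|+\sum_w \mathrm{dist}_G(v,w)$, with distance $\infty$ between disconnected vertices. A Nash equilibrium is a strategy tuple in which no agent can strictly lower its cost by unilaterally changing its strategy. The network of a Nash equilibrium is connected. Distance partition: for a vertex $v$, $N_i$ is the set of vertices at distance exactly $i$ from $v$. Children: a vertex $x\in N_i$ with $i\ge 3$ is a child of $y\in N_2$ if there is a path $x=v_i,v_{i-1},\ldots,v_2=y,v_1,v$ with $v_j\in N_j$ for all $j$. -}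

module Defs where

open import Data.Bool using (Bool; true; false; _∨_; _∧_; if_then_else_)
open import Data.Nat using (ℕ; zero; suc; _+_; _∸_; _≤_)
open import Data.Integer as ℤ using (ℤ; +_; -_)
open import Data.Rational as ℚ using (ℚ; _/_)
open import Data.Fin using (Fin; _≟_)
open import Data.List using (List; []; _∷_; map; foldr; allFin)
open import Data.Nat.ListAction using (sum)
open import Data.Bool.ListAction using (any)
open import Data.Maybe using (Maybe; just; nothing)
open import Data.Product using (Σ; ∃; _×_; _,_)
open import Data.Sum using (_⊎_)
open import Data.Empty using (⊥)
open import Data.Unit using (⊤)
open import Relation.Nullary using (¬_)
open import Relation.Nullary.Decidable using (⌊_⌋)
open import Relation.Binary.PropositionalEquality using (_≡_)

-- Real numbers as (two-sided) Dedekind cuts of ℚ.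
-- L q  means  q < α ;  U q  means  α < q.

record ℝ : Set₁ where
  field
    L U         : ℚ → Set
    L-inhabited : ∃ λ q → L q
    U-inhabited : ∃ λ q → U q
    L-lower     : ∀ {p q} → p ℚ.< q → L q → L p
    U-upper     : ∀ {p q} → p ℚ.< q → U p → U q
    L-rounded   : ∀ {q} → L q → ∃ λ r → q ℚ.< r × L r
    U-rounded   : ∀ {r} → U r → ∃ λ q → q ℚ.< r × U q
    disjoint    : ∀ {q} → L q → U q → ⊥
    located     : ∀ {q r} → q ℚ.< r → L q ⊎ U r

open ℝ public

ℤ→ℚ : ℤ → ℚ
ℤ→ℚ k = k / 1

-- α is an integer k  iff  neither k < α nor α < k
IsNonInteger : ℝ → Set
IsNonInteger α = ∀ (k : ℤ) → ¬ (¬ L α (ℤ→ℚ k) × ¬ U α (ℤ→ℚ k))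

GreaterThanTwo : ℝ → Set
GreaterThanTwo α = L α (ℤ→ℚ (+ 2))

-- m = ⌊α - 1⌋ for m : ℕ  iff  m ≤ α - 1 < m + 1,
-- i.e.  ¬ (α < m + 1)  and  α < m + 2.
IsFloorOfαMinus1 : ℝ → ℕ → Set
IsFloorOfαMinus1 α m = ¬ U α (ℤ→ℚ (+ (m + 1))) × U α (ℤ→ℚ (+ (m + 2)))

-- Comparison of real-affine quantities:
--   Lt α a b c d   means   α·a + b < α·c + d      (a b c d : ℕ)
-- which is  α·(a ∸ c) < (d - b)  if a > c,
--           (b - d) < α·(c ∸ a)  if c > a,
--           b < d                 if a = c.
ltAux : ℝ → ℕ → ℕ → ℤ → Set
ltAux α (suc k) _       z = U α (z / suc k)
ltAux α zero    (suc k) z = L α ((- z) / suc k)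
ltAux α zero    zero    z = ℤ.+0 ℤ.< z

Lt : ℝ → ℕ → ℕ → ℕ → ℕ → Set
Lt α a b c d = ltAux α (a ∸ c) (c ∸ a) (+ d ℤ.- + b)

-- s v w = true  iff  w ∈ S_v  (v buys the edge {v,w})
Strategies : ℕ → Set
Strategies n = Fin n → Fin n → Bool

Legal : ∀ {n} → Strategies n → Set
Legal s = ∀ v → s v v ≡ false

adj : ∀ {n} → Strategies n → Fin n → Fin n → Bool
adj s v w = s v w ∨ s w v

numBought : ∀ {n} → (Fin n → Bool) → ℕ
numBought {n} t = sum (map (λ w → if t w then 1 else 0) (allFin n))

reach : ∀ {n} → Strategies n → ℕ → Fin n → Fin n → Bool
reach s zero    v w = ⌊ v ≟ w ⌋
reach {n} s (suc k) v w = reach s k v w ∨ any (λ u → reach s k v u ∧ adj s u w) (allFin n)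

search : (ℕ → Bool) → ℕ → ℕ → Maybe ℕ
search p k zero       = nothing
search p k (suc fuel) = if p k then just k else search p (suc k) fuel

-- dist_G(v,w); nothing encodes ∞.  (Finite distances in an n-vertex graph
-- are < n, so searching k = 0 … n-1 is exhaustive.)
dist : ∀ {n} → Strategies n → Fin n → Fin n → Maybe ℕ
dist {n} s v w = search (λ k → reach s k v w) 0 n

addM : Maybe ℕ → Maybe ℕ → Maybe ℕ
addM (just a) (just b) = just (a + b)
addM _        _        = nothing

totalDist : ∀ {n} → Strategies n → Fin n → Maybe ℕ
totalDist {n} s v = foldr addM (just 0) (map (dist s v) (allFin n))

CostLt : ℝ → ℕ → Maybe ℕ → ℕ → Maybe ℕ → Set
CostLt α a' nothing   a _        = ⊥
CostLt α a' (just d') a nothing  = ⊤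
CostLt α a' (just d') a (just d) = Lt α a' d' a d

deviate : ∀ {n} → Strategies n → Fin n → (Fin n → Bool) → Strategies n
deviate s u t v with v ≟ u
... | Relation.Nullary.yes _ = t
... | Relation.Nullary.no  _ = s v

IsNash : ∀ {n} → ℝ → Strategies n → Set
IsNash {n} α s =
  Legal s ×
  (∀ (u : Fin n) (t : Fin n → Bool) → t u ≡ false →
     ¬ CostLt α (numBought t) (totalDist (deviate s u t) u)
                (numBought (s u)) (totalDist s u))

InLayer : ∀ {n} → Strategies n → Fin n → ℕ → Fin n → Set
InLayer s v i x = dist s v x ≡ just i

-- LayerPath s v y i x : there is a path  x = v_i, v_{i-1}, …, v_2 = y, v_1, v
-- with v_j ∈ N_j for all j (consecutive vertices adjacent).
data LayerPath {n} (s : Strategies n) (v y : Fin n) : ℕ → Fin n → Set where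
  start : (v₁ : Fin n) → InLayer s v 1 v₁ → adj s v₁ v ≡ true →
          adj s y v₁ ≡ true → InLayer s v 2 y → LayerPath s v y 2 y
  step  : ∀ {i u w} → LayerPath s v y i u → adj s u w ≡ true →
          InLayer s v (suc i) w → LayerPath s v y (suc i) w

IsChild : ∀ {n} → Strategies n → Fin n → Fin n → Fin n → Set
IsChild s v y x = ∃ λ i → 3 ≤ i × LayerPath s v y i x

-- If y ∈ N₂ had k > ⌊α - 1⌋ children, then v could buy the edge {v, y}:
-- this costs α, but brings y from distance 2 to 1 and every child of y
-- one step closer, so v's distance sum drops by k + 1 ≥ ⌊α - 1⌋ + 2 > α,
-- contradicting equilibrium.
module Submission where

open import Defs
open import Data.Bool using (Bool; true; false; _∨_; _∧_; if_then_else_; not)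
open import Data.Bool.Properties using (¬-not)
open import Data.Bool.ListAction using (any)
open import Data.Empty using (⊥-elim)
open import Data.Fin using (Fin; zero; suc; _≟_)
open import Data.Fin.Properties using (nonZeroIndex)
import Data.Integer as ℤ
import Data.Integer.Properties as ℤ
open import Data.List using (List; []; _∷_; map; foldr; allFin; length; tabulate)
open import Data.List.Membership.Propositional using (_∈_)
open import Data.List.Membership.Propositional.Properties using (∈-allFin)
open import Data.List.Properties using (map-cong; map-tabulate)
open import Data.List.Relation.Unary.All as All using (All; []; _∷_)
open import Data.List.Relation.Unary.AllPairs using ([]; _∷_)
open import Data.List.Relation.Unary.Any using (here; there)
open import Data.List.Relation.Unary.Unique.Propositional using (Unique)
open import Data.Maybe using (Maybe; just; nothing)
open import Data.Maybe.Properties using (just-injective)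
open import Data.Nat using (ℕ; zero; suc; _+_; _∸_; _≤_; _<_; z≤n; s≤s; s≤s⁻¹; z<s; _<?_; >-nonZero⁻¹)
open import Data.Nat.Coprimality using (1-coprimeTo)
import Data.Nat.Coprimality as Coprime
open import Data.Nat.ListAction using (sum)
open import Data.Nat.Properties hiding (_≟_)
open import Data.Product using (∃; ∃-syntax; _×_; _,_; proj₁; proj₂; map₂)
import Data.Rational as ℚ
import Data.Rational.Properties as ℚ
open import Data.Sum using (_⊎_; inj₁; inj₂)
open import Data.Unit using (tt)
open import Function using (_∘_)
open import Relation.Nullary using (does; yes; no; contradiction)
open import Relation.Nullary.Decidable using (⌊_⌋; isYes≗does; dec-true; dec-false)
open import Relation.Binary.PropositionalEquality

∨-introˡ : ∀ {a} b → a ≡ true → a ∨ b ≡ true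
∨-introˡ b refl = refl

∨-introʳ : ∀ a {b} → b ≡ true → a ∨ b ≡ true
∨-introʳ true  refl = refl
∨-introʳ false refl = refl

∨-elim : ∀ a {b} → a ∨ b ≡ true → a ≡ true ⊎ b ≡ true
∨-elim true  _ = inj₁ refl
∨-elim false e = inj₂ e

∧-elim : ∀ a {b} → a ∧ b ≡ true → a ≡ true × b ≡ true
∧-elim true e = refl , e

any-intro : ∀ {A : Set} (p : A → Bool) {x} {xs} → x ∈ xs → p x ≡ true → any p xs ≡ true
any-intro p {xs = y ∷ _} (here refl) px = ∨-introˡ _ px
any-intro p {xs = y ∷ _} (there x∈xs) px = ∨-introʳ (p y) (any-intro p x∈xs px)

any-elim : ∀ {A : Set} (p : A → Bool) (xs : List A) → any p xs ≡ true → ∃[ x ] p x ≡ true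
any-elim p (y ∷ xs) e with ∨-elim (p y) e
... | inj₁ py = y , py
... | inj₂ e′ = any-elim p xs e′

⌊≟⌋-diag : ∀ {n} (v : Fin n) → ⌊ v ≟ v ⌋ ≡ true
⌊≟⌋-diag v = trans (isYes≗does (v ≟ v)) (dec-true (v ≟ v) refl)

search-sound : ∀ p i f {k} → search p i f ≡ just k → p k ≡ true × k < i + f
search-sound p i (suc f) e with p i in pi
search-sound p i (suc f) refl | true  = pi , m<m+n i z<s
search-sound p i (suc f) {k} e | false with search-sound p (suc i) f e
... | pk , k< = pk , subst (k <_) (sym (+-suc i f)) k<

search-complete : ∀ p i f {k} → p k ≡ true → i ≤ k → k < i + f →
                  ∃[ j ] search p i f ≡ just j × j ≤ k
search-complete p i zero    {k} pk i≤k k< = contradiction i≤k (<⇒≱ (subst (k <_) (+-identityʳ i) k<))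
search-complete p i (suc f) {k} pk i≤k k< with p i in pi
... | true  = i , refl , i≤k
... | false with m≤n⇒m<n∨m≡n i≤k
...   | inj₂ refl = contradiction (trans (sym pk) pi) λ ()
...   | inj₁ i<k  = search-complete p (suc i) f pk i<k (subst (k <_) (+-suc i f) k<)

distinct⇒1<n : ∀ {n} {v w : Fin n} → v ≢ w → 1 < n
distinct⇒1<n {suc zero}    {zero} {zero} v≢w = contradiction refl v≢w
distinct⇒1<n {suc (suc _)} _ = s≤s (s≤s z≤n)

module _ {n : ℕ} where

  Subgraph : Strategies n → Strategies n → Set
  Subgraph s s′ = ∀ a b → adj s a b ≡ true → adj s′ a b ≡ true

  reach-step : ∀ (s : Strategies n) {k v u w} → reach s k v u ≡ true → adj s u w ≡ true →
               reach s (suc k) v w ≡ true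
  reach-step s {k} {v} {u} {w} r a =
    ∨-introʳ (reach s k v w)
      (any-intro (λ u → reach s k v u ∧ adj s u w) (∈-allFin u) (subst (λ b → b ∧ adj s u w ≡ true) (sym r) a))

  reach-refl : ∀ (s : Strategies n) v → reach s 0 v v ≡ true
  reach-refl s v = ⌊≟⌋-diag v

  reach-adj : ∀ (s : Strategies n) {v w} → adj s v w ≡ true → reach s 1 v w ≡ true
  reach-adj s {v} a = reach-step s {0} {v} (reach-refl s v) a

  reach-mono : ∀ {s s′ : Strategies n} → Subgraph s s′ → ∀ k {v w} →
               reach s k v w ≡ true → reach s′ k v w ≡ true
  reach-mono sub zero    r = r
  reach-mono {s} {s′} sub (suc k) {v} {w} r with ∨-elim (reach s k v w) r
  ... | inj₁ r′ = ∨-introˡ _ (reach-mono sub k r′)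
  ... | inj₂ r′ with any-elim _ (allFin n) r′
  ...   | u , ru with ∧-elim (reach s k v u) ru
  ...     | rvu , auw = reach-step s′ {k} {v} (reach-mono sub k rvu) (sub u w auw)

  module _ (s : Strategies n) {v w : Fin n} where

    dist-sound : ∀ {d} → dist s v w ≡ just d → reach s d v w ≡ true × d < n
    dist-sound = search-sound (λ k → reach s k v w) 0 n

    dist-complete : ∀ {k} → reach s k v w ≡ true → k < n → ∃[ d ] dist s v w ≡ just d × d ≤ k
    dist-complete r k<n = search-complete (λ k → reach s k v w) 0 n r z≤n k<n

    reach⇒dist≤ : ∀ {d k} → dist s v w ≡ just d → reach s k v w ≡ true → d ≤ k
    reach⇒dist≤ {d} {k} e r with k <? n
    ... | no  k≮n = <⇒≤ (<-≤-trans (proj₂ (dist-sound e)) (≮⇒≥ k≮n))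
    ... | yes k<n with dist-complete r k<n
    ...   | d′ , e′ , d′≤k = subst (_≤ k) (just-injective (trans (sym e′) e)) d′≤k

  ∑ : (Fin n → ℕ) → ℕ
  ∑ f = sum (map f (allFin n))

  ∑-cong : ∀ {f g : Fin n → ℕ} → (∀ w → f w ≡ g w) → ∑ f ≡ ∑ g
  ∑-cong f≗g = cong sum (map-cong f≗g (allFin n))

  ∑-mono : ∀ {f g : Fin n → ℕ} → (∀ w → f w ≤ g w) → ∑ f ≤ ∑ g
  ∑-mono {f} {g} f≤g = go (allFin n)
    where
    go : ∀ ws → sum (map f ws) ≤ sum (map g ws)
    go []       = z≤n
    go (w ∷ ws) = +-mono-≤ (f≤g w) (go ws)

bump : ∀ {n} → (Fin n → ℕ) → Fin n → Fin n → ℕ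
bump f z w = if does (w ≟ z) then suc (f w) else f w

sum-tabulate-bump : ∀ {n} (f : Fin n → ℕ) z → sum (tabulate (bump f z)) ≡ suc (sum (tabulate f))
sum-tabulate-bump f zero    = refl
sum-tabulate-bump f (suc z) = trans (cong (f zero +_) (sum-tabulate-bump (λ w → f (suc w)) z)) (+-suc (f zero) _)

∑-bump : ∀ {n} (f : Fin n → ℕ) z → ∑ (bump f z) ≡ suc (∑ f)
∑-bump f z = begin
  ∑ (bump f z)                 ≡⟨ cong sum (map-tabulate (λ w → w) (bump f z)) ⟩
  sum (tabulate (bump f z))    ≡⟨ sum-tabulate-bump f z ⟩
  suc (sum (tabulate f))       ≡⟨ cong (suc ∘ sum) (map-tabulate (λ w → w) f) ⟨
  suc (∑ f)                    ∎
  where open ≡-Reasoning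

bump-≢ : ∀ {n} (f : Fin n → ℕ) {z w} → w ≢ z → bump f z w ≡ f w
bump-≢ f {z} {w} w≢z rewrite dec-false (w ≟ z) w≢z = refl

bump-≤ : ∀ {n} {f g : Fin n → ℕ} {z} → (∀ w → f w ≤ g w) → f z < g z → ∀ w → bump f z w ≤ g w
bump-≤ {z = z} f≤g fz<gz w with w ≟ z
... | yes refl = fz<gz
... | no  _    = f≤g w

∑-strict : ∀ {n} {f g : Fin n → ℕ} {zs} → (∀ w → f w ≤ g w) → Unique zs → All (λ z → f z < g z) zs →
           length zs + ∑ f ≤ ∑ g
∑-strict f≤g [] [] = ∑-mono f≤g
∑-strict {f = f} {g} {z ∷ zs} f≤g (z∉zs ∷ uzs) (fz<gz ∷ lt) = begin
  suc (length zs) + ∑ f        ≡⟨ +-suc (length zs) (∑ f) ⟨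
  length zs + suc (∑ f)        ≡⟨ cong (length zs +_) (∑-bump f z) ⟨
  length zs + ∑ (bump f z)     ≤⟨ ∑-strict (bump-≤ f≤g fz<gz) uzs bumped<g ⟩
  ∑ g                          ∎
  where
  open ≤-Reasoning
  bumped<g : All (λ w → bump f z w < g w) zs
  bumped<g = All.zipWith (λ (z≢w , fw<gw) → subst (_< _) (sym (bump-≢ f (z≢w ∘ sym))) fw<gw) (z∉zs , lt)

addM-just⁻ : ∀ a b {c} → addM a b ≡ just c → (∃[ a′ ] a ≡ just a′) × (∃[ b′ ] b ≡ just b′)
addM-just⁻ (just a) (just b) _ = (a , refl) , (b , refl)

module _ {A : Set} (f : A → Maybe ℕ) where

  foldr-addM-just : (g : A → ℕ) → (∀ x → f x ≡ just (g x)) → ∀ xs →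
                    foldr addM (just 0) (map f xs) ≡ just (sum (map g xs))
  foldr-addM-just g f≡g []       = refl
  foldr-addM-just g f≡g (x ∷ xs) rewrite f≡g x | foldr-addM-just g f≡g xs = refl

  foldr-addM-just⁻ : ∀ {xs D x} → foldr addM (just 0) (map f xs) ≡ just D → x ∈ xs → ∃[ d ] f x ≡ just d
  foldr-addM-just⁻ {y ∷ _} e (here refl)  = proj₁ (addM-just⁻ (f y) _ e)
  foldr-addM-just⁻ {y ∷ _} e (there x∈xs) with addM-just⁻ (f y) _ e
  ... | _ , (_ , e′) = foldr-addM-just⁻ e′ x∈xs

module _ {n : ℕ} where

  DistFrom : Strategies n → Fin n → (Fin n → ℕ) → Set
  DistFrom s v g = ∀ w → dist s v w ≡ just (g w)

  module _ {s : Strategies n} {v : Fin n} where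

    totalDist-DistFrom : ∀ {g} → DistFrom s v g → totalDist s v ≡ just (∑ g)
    totalDist-DistFrom {g} dg = foldr-addM-just (dist s v) g dg (allFin n)

    choose-DistFrom : (∀ w → ∃[ d ] dist s v w ≡ just d) → ∃[ g ] DistFrom s v g
    choose-DistFrom h = (λ w → proj₁ (h w)) , (λ w → proj₂ (h w))

    totalDist-just⇒DistFrom : ∀ {D} → totalDist s v ≡ just D → ∃[ g ] DistFrom s v g
    totalDist-just⇒DistFrom e = choose-DistFrom λ w → foldr-addM-just⁻ (dist s v) e (∈-allFin w)

    DistFrom-⊆ : ∀ {s′ g} → Subgraph s s′ → DistFrom s v g →
                 ∃[ g′ ] DistFrom s′ v g′ × (∀ w → g′ w ≤ g w)
    DistFrom-⊆ {s′} {g} sub dg = g′ , dg′ , g′≤g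
      where
      closer : ∀ w → ∃[ d ] dist s′ v w ≡ just d × d ≤ g w
      closer w with dist-sound s (dg w)
      ... | r , gw<n = dist-complete s′ (reach-mono sub (g w) r) gw<n
      g′ : Fin n → ℕ
      g′ w = proj₁ (closer w)
      dg′ : DistFrom s′ v g′
      dg′ w = proj₁ (proj₂ (closer w))
      g′≤g : ∀ w → g′ w ≤ g w
      g′≤g w = proj₂ (proj₂ (closer w))

  module _ (s : Strategies n) (u : Fin n) (t : Fin n → Bool) where

    deviate-self : deviate s u t u ≡ t
    deviate-self with u ≟ u
    ... | yes _   = refl
    ... | no  u≢u = contradiction refl u≢u

    adj-deviate : ∀ {w} → t w ≡ true → adj (deviate s u t) u w ≡ true
    adj-deviate {w} tw = ∨-introˡ _ (trans (cong (λ t′ → t′ w) deviate-self) tw)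

    deviate-keeps : (∀ w → s u w ≡ true → t w ≡ true) → ∀ a b → s a b ≡ true → deviate s u t a b ≡ true
    deviate-keeps keeps a b sab with a ≟ u
    ... | yes refl = keeps b sab
    ... | no  _    = sab

    deviate-⊇ : (∀ w → s u w ≡ true → t w ≡ true) → Subgraph s (deviate s u t)
    deviate-⊇ keeps a b e with ∨-elim (s a b) e
    ... | inj₁ sab = ∨-introˡ _ (deviate-keeps keeps a b sab)
    ... | inj₂ sba = ∨-introʳ (deviate s u t a b) (deviate-keeps keeps b a sba)

buy : ∀ {n} → Fin n → (Fin n → Bool) → Fin n → Bool
buy y t w = does (w ≟ y) ∨ t w

module _ {n : ℕ} (s : Strategies n) (v y : Fin n) where

  buy-⊇ : Subgraph s (deviate s v (buy y (s v)))
  buy-⊇ = deviate-⊇ s v (buy y (s v)) (λ _ → ∨-introʳ _)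

  adj-buy : adj (deviate s v (buy y (s v))) v y ≡ true
  adj-buy = adj-deviate s v (buy y (s v)) (∨-introˡ _ (dec-true (y ≟ y) refl))

numBought-buy : ∀ {n} (t : Fin n → Bool) {y} → t y ≡ false → numBought (buy y t) ≡ suc (numBought t)
numBought-buy t {y} ty = trans (∑-cong indicator-buy) (∑-bump (λ w → if t w then 1 else 0) y)
  where
  indicator-buy : ∀ w → (if buy y t w then 1 else 0) ≡ bump (λ w → if t w then 1 else 0) y w
  indicator-buy w with w ≟ y
  ... | yes refl rewrite ty = refl
  ... | no  _    = refl

ℕ→ℚ-mono-< : ∀ {p q} → p < q → ℤ→ℚ (ℤ.+ p) ℚ.< ℤ→ℚ (ℤ.+ q)
ℕ→ℚ-mono-< {p} {q} p<q
  rewrite ℚ.normalize-coprime (Coprime.sym (1-coprimeTo p))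
        | ℚ.normalize-coprime (Coprime.sym (1-coprimeTo q))
  = ℚ.*<* (subst₂ ℤ._<_ (sym (ℤ.*-identityʳ (ℤ.+ p))) (sym (ℤ.*-identityʳ (ℤ.+ q))) (ℤ.+<+ p<q))

U-mono : (α : ℝ) {p q : ℕ} → p ≤ q → U α (ℤ→ℚ (ℤ.+ p)) → U α (ℤ→ℚ (ℤ.+ q))
U-mono α p≤q αU with m≤n⇒m<n∨m≡n p≤q
... | inj₁ p<q  = U-upper α (ℕ→ℚ-mono-< p<q) αU
... | inj₂ refl = αU

Lt-oneMoreEdge : (α : ℝ) {q a D′ D : ℕ} → U α (ℤ→ℚ (ℤ.+ q)) → q + D′ ≤ D → Lt α (suc a) D′ a D
Lt-oneMoreEdge α {q} {a} {D′} {D} α<q q+D′≤D =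
  subst₂ (λ i j → ltAux α i j (ℤ.+ D ℤ.- ℤ.+ D′)) (sym (m+n∸n≡m 1 a)) (sym (m≤n⇒m∸n≡0 (n≤1+n a)))
    (subst (λ z → U α (ℤ→ℚ z)) (sym D-D′≡D∸D′) (U-mono α (m+n≤o⇒m≤o∸n q q+D′≤D) α<q))
  where
  D-D′≡D∸D′ : ℤ.+ D ℤ.- ℤ.+ D′ ≡ ℤ.+ (D ∸ D′)
  D-D′≡D∸D′ = trans (ℤ.m-n≡m⊖n D D′) (ℤ.⊖-≥ (m+n≤o⇒n≤o q q+D′≤D))

module _ (α : ℝ) {n : ℕ} (s : Strategies n) (nash : IsNash α s) where

  -- If some vertex were unreachable from v, buying all edges would make v's cost finite.
  nash⇒DistFrom : ∀ v → ∃[ g ] DistFrom s v g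
  nash⇒DistFrom v with totalDist s v in eq
  ... | just _  = totalDist-just⇒DistFrom eq
  ... | nothing = ⊥-elim (proj₂ nash v all all-v cheaper)
    where
    all : Fin n → Bool
    all w = not (does (w ≟ v))
    all-v : all v ≡ false
    all-v rewrite dec-true (v ≟ v) refl = refl
    s* : Strategies n
    s* = deviate s v all
    reachable : ∀ w → ∃[ d ] dist s* v w ≡ just d
    reachable w with w ≟ v
    ... | yes refl = map₂ proj₁ (dist-complete s* (reach-refl s* v) (>-nonZero⁻¹ n {{nonZeroIndex v}}))
    ... | no  w≢v  = map₂ proj₁ (dist-complete s* (reach-adj s* (adj-deviate s v all all-w)) (distinct⇒1<n (w≢v ∘ sym)))
      where
      all-w : all w ≡ true
      all-w = cong not (dec-false (w ≟ v) w≢v)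
    cheaper : CostLt α (numBought all) (totalDist s* v) (numBought (s v)) (totalDist s v)
    cheaper rewrite eq | totalDist-DistFrom (proj₂ (choose-DistFrom reachable)) = tt

  nash⇒buy-saving< : ∀ {q v y g g′} → U α (ℤ→ℚ (ℤ.+ q)) → v ≢ y → s v y ≡ false →
                     DistFrom s v g → DistFrom (deviate s v (buy y (s v))) v g′ → ∑ g < q + ∑ g′
  nash⇒buy-saving< {q} {v} {y} {g} {g′} α<q v≢y svy dg dg′ = ≰⇒> λ q+∑g′≤∑g →
    proj₂ nash v (buy y (s v)) buy-v (cheaper q+∑g′≤∑g)
    where
    buy-v : buy y (s v) v ≡ false
    buy-v rewrite dec-false (v ≟ y) v≢y = proj₁ nash v
    cheaper : q + ∑ g′ ≤ ∑ g → CostLt α (numBought (buy y (s v))) (totalDist (deviate s v (buy y (s v))) v)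
                                        (numBought (s v)) (totalDist s v)
    cheaper q+∑g′≤∑g rewrite numBought-buy (s v) svy | totalDist-DistFrom dg | totalDist-DistFrom dg′ =
      Lt-oneMoreEdge α {q} {numBought (s v)} {∑ g′} {∑ g} α<q q+∑g′≤∑g

module _ {n : ℕ} {s : Strategies n} {v y : Fin n} where

  layerPath-layer : ∀ {i x} → LayerPath s v y i x → InLayer s v i x
  layerPath-layer (start _ _ _ _ y∈N₂) = y∈N₂
  layerPath-layer (step _ _ x∈Nᵢ)      = x∈Nᵢ

  -- Going from v straight to y skips v₁, so x ∈ Nᵢ is reached in i − 1 steps.
  layerPath-shortcut : ∀ {s′ i x} → Subgraph s s′ → adj s′ v y ≡ true → LayerPath s v y i x →
                       ∃[ k ] suc k ≡ i × reach s′ k v x ≡ true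
  layerPath-shortcut {s′} sub vy (start _ _ _ _ _) = 1 , refl , reach-adj s′ vy
  layerPath-shortcut {s′} sub vy (step {u = u} {w} p uw _) with layerPath-shortcut {s′} sub vy p
  ... | k , refl , r = suc k , refl , reach-step s′ {k} {v} r (sub u w uw)

lemma2 : (α : ℝ) → GreaterThanTwo α → IsNonInteger α →
         (m : ℕ) → IsFloorOfαMinus1 α m →
         (n : ℕ) (s : Strategies n) → IsNash α s →
         (v y : Fin n) → InLayer s v 2 y →
         (xs : List (Fin n)) → Unique xs → All (IsChild s v y) xs →
         length xs ≤ m
lemma2 α _ _ m (_ , α<m+2) n s nash v y y∈N₂ xs unique-xs children
  with nash⇒DistFrom α s nash v
... | g , dg with DistFrom-⊆ (buy-⊇ s v y) dg
...   | g′ , dg′ , g′≤g = s≤s⁻¹ (s≤s⁻¹ (+-cancelʳ-< (∑ g′) _ _ (≤-<-trans saving bound)))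
  where
  s′ = deviate s v (buy y (s v))
  v≢y : v ≢ y
  v≢y refl = contradiction (reach⇒dist≤ s {k = 0} y∈N₂ (reach-refl s v)) λ ()
  svy : s v y ≡ false
  svy = ¬-not λ svy → contradiction (reach⇒dist≤ s {k = 1} y∈N₂ (reach-adj s (∨-introˡ (s y v) svy))) λ { (s≤s ()) }
  g≡layer : ∀ {x i} → InLayer s v i x → g x ≡ i
  g≡layer x∈Nᵢ = just-injective (trans (sym (dg _)) x∈Nᵢ)
  y-closer : g′ y < g y
  y-closer rewrite g≡layer y∈N₂ = s≤s (reach⇒dist≤ s′ {k = 1} (dg′ y) (reach-adj s′ (adj-buy s v y)))
  child-closer : ∀ {x} → IsChild s v y x → g′ x < g x
  child-closer (i , _ , p) with layerPath-shortcut {s′ = s′} (buy-⊇ s v y) (adj-buy s v y) p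
  ... | k , refl , r rewrite g≡layer (layerPath-layer p) = s≤s (reach⇒dist≤ s′ (dg′ _) r)
  y≢child : ∀ {x} → IsChild s v y x → y ≢ x
  y≢child (i , 3≤i , p) refl with trans (sym (g≡layer y∈N₂)) (g≡layer (layerPath-layer p))
  ... | refl = contradiction 3≤i λ { (s≤s (s≤s ())) }
  saving : suc (length xs) + ∑ g′ ≤ ∑ g
  saving = ∑-strict g′≤g (All.map y≢child children ∷ unique-xs) (y-closer ∷ All.map child-closer children)
  bound : ∑ g < 2 + m + ∑ g′
  bound = nash⇒buy-saving< α s nash (subst (λ q → U α (ℤ→ℚ (ℤ.+ q))) (+-comm m 2) α<m+2) v≢y svy dg dg′
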